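{- \textsc{Greedy} cannot be better than a $(1/2)$-approximation on chordal graphs: for every $\varepsilon>0$ there exists a chordal graph $G$ and an independent set $S$ that can be returned by \textsc{Greedy} on $G$ (for some tie-breaking) such that $|S| < (\frac{1}{2}+\varepsilon)\,\alpha(G)$, where $\alpha(G)$ is the size of a maximum independent set of $G$.
   Context: Graphs are finite, simple, undirected. A graph is chordal if every simple cycle on at least 4 vertices has two non-consecutive vertices that are adjacent. \textsc{Greedy} is the minimum-degree greedy algorithm: start with $S=\emptyset$; while the current graph is nonempty, choose any vertex of minimum degree in the current graph (ties broken arbitrarily/adversarially), add it to $S$ and delete it together with all its neighbours. A solution "can be returned by \textsc{Greedy}" if it is the output for some sequence of tie-breaking choices.
   Formalization: The parameter ε ranges only over the positive rationals. -}

module Defs where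

open import Data.Bool using (Bool; true; false)
open import Data.Nat using (ℕ; suc; _≤_; _<_)
open import Data.Nat.DivMod using (_%_)
open import Data.Fin using (Fin; toℕ)
open import Data.Fin.Subset using (Subset; _∈_; _∩_; _∪_; ∁; ⁅_⁆; ⊥; ∣_∣)
open import Data.Vec using (tabulate)
open import Data.Product using (Σ; _×_; ∃; ∃-syntax)
open import Relation.Binary.PropositionalEquality using (_≡_; _≢_)
open import Relation.Nullary using (¬_)
open import Function.Definitions using (Injective)

record Graph (n : ℕ) : Set where
  field
    adj    : Fin n → Fin n → Bool
    sym    : ∀ u v → adj u v ≡ adj v u
    irrefl : ∀ v → adj v v ≡ false

open Graph public

module _ {n : ℕ} (G : Graph n) where

  Adj : Fin n → Fin n → Set
  Adj u v = adj G u v ≡ true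

  N : Fin n → Subset n
  N v = tabulate (adj G v)

  deg : Subset n → Fin n → ℕ
  deg A v = ∣ A ∩ N v ∣

  remove : Subset n → Fin n → Subset n
  remove A v = A ∩ ∁ (⁅ v ⁆ ∪ N v)

  -- GreedyRun A S : S is a possible output of Greedy started on G[A]
  -- for some sequence of tie-breaking choices.
  data GreedyRun : Subset n → Subset n → Set where
    done : GreedyRun ⊥ ⊥
    step : ∀ {A S} (v : Fin n) → v ∈ A →
           (∀ u → u ∈ A → deg A v ≤ deg A u) →
           GreedyRun (remove A v) S →
           GreedyRun A (⁅ v ⁆ ∪ S)

  GreedyOutput : Subset n → Set
  GreedyOutput S = GreedyRun (Data.Vec.replicate n true) S

  Independent : Subset n → Set
  Independent I = ∀ u v → u ∈ I → v ∈ I → ¬ Adj u v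

  IsIndependenceNumber : ℕ → Set
  IsIndependenceNumber k =
    (Σ (Subset n) λ I → Independent I × ∣ I ∣ ≡ k) ×
    (∀ I → Independent I → ∣ I ∣ ≤ k)

  -- a simple cycle of length suc m (≥ 4 when 3 ≤ m): distinct vertices
  -- c 0, …, c m with c i adjacent to c (i+1 mod (suc m))
  Consecutive : {m : ℕ} → Fin (suc m) → Fin (suc m) → Set
  Consecutive {m} i j = toℕ j ≡ suc (toℕ i) % suc m

  IsCycle : {m : ℕ} → (Fin (suc m) → Fin n) → Set
  IsCycle {m} c = Injective _≡_ _≡_ c × (∀ i j → Consecutive i j → Adj (c i) (c j))

  HasChord : {m : ℕ} → (Fin (suc m) → Fin n) → Set
  HasChord {m} c = ∃[ i ] ∃[ j ]
    (i ≢ j × ¬ Consecutive i j × ¬ Consecutive j i × Adj (c i) (c j))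

  Chordal : Set
  Chordal = ∀ (m : ℕ) → 3 ≤ m → (c : Fin (suc m) → Fin n) → IsCycle c → HasChord c

{-# OPTIONS --safe #-}
-- Take M blocks, each a complete graph on positions 0, …, M + 1 without the edge {0, 1}, and a
-- centre joined to position 0 (the port) of every block. The centre has the minimum degree M, so
-- Greedy may take it first; this deletes every port and leaves M disjoint cliques of size M + 1,
-- from each of which Greedy takes one vertex, say position 1 (the twin of the port): M + 1 vertices.
-- Positions 0 and 1 of all blocks form an independent set of size 2M, and none is larger, since an
-- independent set meets a block in at most two vertices, and in at most one if it contains the
-- centre. The graph is chordal: a cycle cannot pass through the centre, a cut vertex meeting each
-- block in a single vertex, and inside a block the only non-adjacent pair is a port and its twin.
-- Finally M + 1 < (½ + ε) · 2M as soon as M is the denominator of ε.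
module Submission where

open import Data.Bool using (Bool; true; false; not; _∧_; _∨_)
open import Data.Empty using (⊥-elim)
open import Data.Fin using (Fin; zero; suc; toℕ)
open import Data.Fin.Properties using (_≟_)
open import Data.Fin.Subset using (Subset; ⁅_⁆; ∣_∣)
open import Data.Nat using (ℕ; zero; suc; _≤_; _<ᵇ_; z≤n; s≤s; NonZero)
open import Data.Product using (Σ; _×_; _,_; ∃-syntax)
open import Data.Vec using (lookup)
open import Data.Vec.Properties using (lookup-replicate)
open import Function using (_∘_)
open import Relation.Binary.PropositionalEquality
  using (_≡_; _≢_; refl; sym; trans; cong; cong₂; subst; subst₂; module ≡-Reasoning)
open import Relation.Nullary using (yes; no; does)
open import Relation.Nullary.Decidable using (dec-true; dec-false)

open import Defs hiding (sym)

does-≟-sym : ∀ {k} (i j : Fin k) → does (i ≟ j) ≡ does (j ≟ i)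
does-≟-sym i j with i ≟ j
... | yes i≡j = sym (dec-true (j ≟ i) (sym i≡j))
... | no  i≢j = sym (dec-false (j ≟ i) (i≢j ∘ sym))

does-≟-refl : ∀ {k} (i : Fin k) → does (i ≟ i) ≡ true
does-≟-refl i = dec-true (i ≟ i) refl

<ᵇ-suc : ∀ {m n} → m ≢ n → (m <ᵇ suc n) ≡ (m <ᵇ n)
<ᵇ-suc {zero}  {zero}  0≢0 = ⊥-elim (0≢0 refl)
<ᵇ-suc {zero}  {suc n} _   = refl
<ᵇ-suc {suc m} {zero}  _   = refl
<ᵇ-suc {suc m} {suc n} m≢n = <ᵇ-suc (m≢n ∘ cong suc)

n<ᵇn≡false : ∀ n → (n <ᵇ n) ≡ false
n<ᵇn≡false zero    = refl
n<ᵇn≡false (suc n) = n<ᵇn≡false n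

n<ᵇ1+n≡true : ∀ n → (n <ᵇ suc n) ≡ true
n<ᵇ1+n≡true zero    = refl
n<ᵇ1+n≡true (suc n) = n<ᵇ1+n≡true n

toℕ<ᵇn≡true : ∀ {k} (i : Fin k) → (toℕ i <ᵇ k) ≡ true
toℕ<ᵇn≡true zero    = refl
toℕ<ᵇn≡true (suc i) = toℕ<ᵇn≡true i

lookup-⁅⁆ : ∀ {k} (i j : Fin k) → lookup ⁅ i ⁆ j ≡ does (i ≟ j)
lookup-⁅⁆ zero    zero    = refl
lookup-⁅⁆ zero    (suc j) = lookup-replicate j false
lookup-⁅⁆ (suc i) zero    = refl
lookup-⁅⁆ (suc i) (suc j) = lookup-⁅⁆ i j

module Counting where

  open import Data.Fin using (_↑ˡ_; _↑ʳ_; combine)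
  open import Data.Fin.Properties using (suc-injective)
  open import Data.Nat using (_+_; _*_)
  open import Data.Nat.Properties
    using (≤-refl; ≤-trans; ≤-reflexive; +-mono-≤; +-assoc; +-identityʳ; *-identityʳ; *-zeroʳ; m≤m+n; m≤n+m)
  open import Data.Vec using ([]; _∷_)

  ∑ : ∀ {k} → (Fin k → ℕ) → ℕ
  ∑ {zero}  f = 0
  ∑ {suc k} f = f zero + ∑ (f ∘ suc)

  ∑-cong : ∀ {k} {f g : Fin k → ℕ} → (∀ i → f i ≡ g i) → ∑ f ≡ ∑ g
  ∑-cong {zero}  eq = refl
  ∑-cong {suc k} eq = cong₂ _+_ (eq zero) (∑-cong (eq ∘ suc))

  ∑-constant : ∀ {k} {f : Fin k → ℕ} c → (∀ i → f i ≡ c) → ∑ f ≡ k * c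
  ∑-constant {zero}  c eq = refl
  ∑-constant {suc k} c eq = cong₂ _+_ (eq zero) (∑-constant c (eq ∘ suc))

  ∑-bounded : ∀ {k} {f : Fin k → ℕ} c → (∀ i → f i ≤ c) → ∑ f ≤ k * c
  ∑-bounded {zero}  c le = z≤n
  ∑-bounded {suc k} c le = +-mono-≤ (le zero) (∑-bounded c (le ∘ suc))

  ∑-term : ∀ {k} (f : Fin k → ℕ) i → f i ≤ ∑ f
  ∑-term f zero    = m≤m+n _ _
  ∑-term f (suc i) = ≤-trans (∑-term (f ∘ suc) i) (m≤n+m _ _)

  ∑-single : ∀ {k} (f : Fin k → ℕ) i → (∀ j → i ≢ j → f j ≡ 0) → ∑ f ≡ f i
  ∑-single {suc k} f zero others = begin
    f zero + ∑ (f ∘ suc) ≡⟨ cong (f zero +_) (∑-constant 0 λ j → others (suc j) λ ()) ⟩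
    f zero + k * 0       ≡⟨ cong (f zero +_) (*-zeroʳ k) ⟩
    f zero + 0           ≡⟨ +-identityʳ _ ⟩
    f zero               ∎
    where open ≡-Reasoning
  ∑-single {suc k} f (suc i) others = cong₂ _+_ (others zero λ ())
    (∑-single (f ∘ suc) i λ j i≢j → others (suc j) (i≢j ∘ suc-injective))

  ∑-++ : ∀ m {k} (f : Fin (m + k) → ℕ) → ∑ f ≡ ∑ (f ∘ (_↑ˡ k)) + ∑ (f ∘ (m ↑ʳ_))
  ∑-++ zero    f = refl
  ∑-++ (suc m) f = trans (cong (f zero +_) (∑-++ m (f ∘ suc))) (sym (+-assoc (f zero) _ _))

  ∑-combine : ∀ m {k} (f : Fin (m * k) → ℕ) → ∑ f ≡ ∑ {m} λ i → ∑ (f ∘ combine i)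
  ∑-combine zero        f = refl
  ∑-combine (suc m) {k} f =
    trans (∑-++ k f) (cong (∑ (f ∘ (_↑ˡ m * k)) +_) (∑-combine m (f ∘ (k ↑ʳ_))))

  bit : Bool → ℕ
  bit true  = 1
  bit false = 0

  bit≤1 : ∀ b → bit b ≤ 1
  bit≤1 true  = ≤-refl
  bit≤1 false = z≤n

  count : ∀ {k} → (Fin k → Bool) → ℕ
  count f = ∑ (bit ∘ f)

  count-cong : ∀ {k} {f g : Fin k → Bool} → (∀ i → f i ≡ g i) → count f ≡ count g
  count-cong eq = ∑-cong (cong bit ∘ eq)

  ∣p∣≡count : ∀ {k} (p : Subset k) → ∣ p ∣ ≡ count (lookup p)
  ∣p∣≡count []          = refl
  ∣p∣≡count (true ∷ p)  = cong suc (∣p∣≡count p)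
  ∣p∣≡count (false ∷ p) = ∣p∣≡count p

  count-true : ∀ k → count {k} (λ _ → true) ≡ k
  count-true k = trans (∑-constant {k} 1 λ _ → refl) (*-identityʳ k)

  count-false : ∀ {k} {f : Fin k → Bool} → (∀ i → f i ≡ false) → count f ≡ 0
  count-false {k} none = trans (∑-constant 0 (cong bit ∘ none)) (*-zeroʳ k)

  count-≟ : ∀ {k} (p : Fin k) → count (λ q → does (p ≟ q)) ≡ 1
  count-≟ {suc k} zero    = cong suc (count-false {k} λ _ → refl)
  count-≟         (suc p) = count-≟ p

  count-≢ : ∀ {k} (p : Fin (suc k)) → count (λ q → not (does (p ≟ q))) ≡ k
  count-≢ {k}     zero    = count-true k
  count-≢ {suc k} (suc p) = cong suc (count-≢ p)

  count-≤1 : ∀ {k} (f : Fin k → Bool) → (∀ p q → f p ≡ true → f q ≡ true → p ≡ q) →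
             count f ≤ 1
  count-≤1 {zero}  f unique = z≤n
  count-≤1 {suc k} f unique with f zero in f₀
  ... | true  = ≤-reflexive (cong suc (count-false rest))
    where
    rest : ∀ q → f (suc q) ≡ false
    rest q with f (suc q) in f₁
    ... | true  with () ← unique zero (suc q) f₀ f₁
    ... | false = refl
  ... | false = count-≤1 (f ∘ suc) λ p q fp fq → suc-injective (unique (suc p) (suc q) fp fq)

module Block where

  open Counting using (bit; count; count-true; count-false; count-≢; count-≤1)
  open import Data.Fin.Patterns using (0F; 1F)
  open import Data.Fin.Properties using (suc-injective)
  open import Data.Nat using (_+_)
  open import Data.Nat.Properties using (≤-trans; ≤-reflexive; +-monoʳ-≤; m≤n+m)
  open import Data.Sum using (_⊎_; inj₁; inj₂)

  blockAdj : ∀ {k} → Fin k → Fin k → Bool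
  blockAdj 0F            0F            = false
  blockAdj 0F            1F            = false
  blockAdj 0F            (suc (suc _)) = true
  blockAdj (suc p)       (suc q)       = not (does (p ≟ q))
  blockAdj 1F            0F            = false
  blockAdj (suc (suc _)) 0F            = true

  low : ∀ {k} → Fin k → Bool
  low 0F            = true
  low 1F            = true
  low (suc (suc _)) = false

  low-suc : ∀ {k} {p : Fin (suc k)} → low (suc p) ≡ true → p ≡ 0F
  low-suc {p = 0F} _ = refl

  blockAdj-sym : ∀ {k} (p q : Fin k) → blockAdj p q ≡ blockAdj q p
  blockAdj-sym 0F            0F            = refl
  blockAdj-sym 0F            1F            = refl
  blockAdj-sym 0F            (suc (suc _)) = refl
  blockAdj-sym 1F            0F            = refl
  blockAdj-sym (suc (suc _)) 0F            = refl
  blockAdj-sym (suc p)       (suc q)       = cong not (does-≟-sym p q)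

  blockAdj-irrefl : ∀ {k} (p : Fin k) → blockAdj p p ≡ false
  blockAdj-irrefl 0F      = refl
  blockAdj-irrefl (suc p) = cong not (does-≟-refl p)

  low⇒non-adjacent : ∀ {k} {p q : Fin k} → low p ≡ true → low q ≡ true → blockAdj p q ≡ false
  low⇒non-adjacent {p = 0F} {0F} _ _ = refl
  low⇒non-adjacent {p = 0F} {1F} _ _ = refl
  low⇒non-adjacent {p = 1F} {0F} _ _ = refl
  low⇒non-adjacent {p = 1F} {1F} _ _ = refl

  non-adjacent⇒low : ∀ {k} {p q : Fin k} → p ≢ q → blockAdj p q ≡ false → low p ≡ true
  non-adjacent⇒low {p = 0F}                 _   _ = refl
  non-adjacent⇒low {p = 1F}                 _   _ = refl
  non-adjacent⇒low {p = suc (suc p)} {0F}    _   ()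
  non-adjacent⇒low {p = suc (suc p)} {suc q} p≢q h
    with () ← trans (cong not (sym (dec-false (suc p ≟ q) (p≢q ∘ cong suc)))) h

  block-chord : ∀ {k} {p₀ p₁ p₂ p₃ : Fin k} → blockAdj p₀ p₁ ≡ true → p₀ ≢ p₂ → p₁ ≢ p₃ →
                blockAdj p₀ p₂ ≡ true ⊎ blockAdj p₁ p₃ ≡ true
  block-chord {p₀ = p₀} {p₁} {p₂} {p₃} a₀₁ p₀≢p₂ p₁≢p₃
    with blockAdj p₀ p₂ in a₀₂ | blockAdj p₁ p₃ in a₁₃
  ... | true  | _    = inj₁ refl
  ... | false | true = inj₂ refl
  ... | false | false with () ← trans (sym a₀₁)
    (low⇒non-adjacent (non-adjacent⇒low p₀≢p₂ a₀₂) (non-adjacent⇒low p₁≢p₃ a₁₃))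

  count-independent : ∀ {k} (f : Fin (2 + k) → Bool) →
                      (∀ p q → f p ≡ true → f q ≡ true → blockAdj p q ≡ false) →
                      count f ≤ bit (f 0F) + 1
  count-independent f independent = +-monoʳ-≤ (bit (f 0F)) (count-≤1 (f ∘ suc) unique)
    where
    unique : ∀ p q → f (suc p) ≡ true → f (suc q) ≡ true → p ≡ q
    unique p q fp fq with p ≟ q
    ... | yes p≡q = p≡q
    ... | no  p≢q = trans (low-suc (non-adjacent⇒low (p≢q ∘ suc-injective) (independent _ _ fp fq)))
      (sym (low-suc (non-adjacent⇒low (p≢q ∘ sym ∘ suc-injective) (independent _ _ fq fp))))

  count-low : ∀ k → count {2 + k} low ≡ 2
  count-low k = cong (2 +_) (count-false {k} λ _ → refl)

  count-blockAdj : ∀ {k} (p : Fin (2 + k)) → k ≤ count (blockAdj p)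
  count-blockAdj {k} 0F      = ≤-reflexive (sym (count-true k))
  count-blockAdj     (suc p) =
    ≤-trans (≤-reflexive (sym (count-≢ p))) (m≤n+m _ (bit (blockAdj (suc p) 0F)))

  twin-dominates : ∀ {k} (q : Fin (2 + k)) →
                   not (does (0F ≟ q)) ∧ not (does (1F ≟ q) ∨ blockAdj 1F q) ≡ false
  twin-dominates 0F            = refl
  twin-dominates 1F            = refl
  twin-dominates (suc (suc q)) = refl

module Modular (L : ℕ) .{{_ : NonZero L}} where

  open import Data.Fin.Properties using (toℕ-injective; toℕ-fromℕ<; toℕ<n)
  open import Data.Nat using (_+_; _*_; _<_; _%_; _/_)
  open import Data.Nat.DivMod
    using (_mod_; m≡m%n+[m/n]*n; m%n<n; m<n⇒m%n≡m; [m+n]%n≡m%n; %-distribˡ-+; m%n%n≡m%n)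
  open import Data.Nat.Properties using (≤-trans; +-cancelˡ-≡; <-irrefl; m≤m+n)

  toℕ-mod : ∀ x → toℕ (x mod L) ≡ x % L
  toℕ-mod x = toℕ-fromℕ< (m%n<n x L)

  toℕ-mod-toℕ : ∀ (t : Fin L) → toℕ t mod L ≡ t
  toℕ-mod-toℕ t = toℕ-injective (trans (toℕ-mod (toℕ t)) (m<n⇒m%n≡m (toℕ<n t)))

  +-mod-period : ∀ x → (x + L) mod L ≡ x mod L
  +-mod-period x =
    toℕ-injective (trans (toℕ-mod (x + L)) (trans ([m+n]%n≡m%n x L) (sym (toℕ-mod x))))

  toℕ-suc-mod : ∀ x → toℕ (suc x mod L) ≡ suc (toℕ (x mod L)) % L
  toℕ-suc-mod x = begin
    toℕ (suc x mod L)           ≡⟨ toℕ-mod (suc x) ⟩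
    (1 + x) % L                 ≡⟨ %-distribˡ-+ 1 x L ⟩
    (1 % L + x % L) % L         ≡⟨ cong (λ r → (1 % L + r) % L) (sym (m%n%n≡m%n x L)) ⟩
    (1 % L + x % L % L) % L     ≡⟨ %-distribˡ-+ 1 (x % L) L ⟨
    (1 + x % L) % L             ≡⟨ cong (λ r → suc r % L) (toℕ-mod x) ⟨
    suc (toℕ (x mod L)) % L     ∎
    where open ≡-Reasoning

  +-%-≢ : ∀ a d → 0 < d → d < L → (a + d) % L ≢ a
  +-%-≢ a d 0<d d<L eq = d≢multiple ((a + d) / L)
    (+-cancelˡ-≡ a d _ (trans (m≡m%n+[m/n]*n (a + d) L) (cong (_+ (a + d) / L * L) eq)))
    where
    d≢multiple : ∀ q → d ≢ q * L
    d≢multiple zero    d≡0  = <-irrefl (sym d≡0) 0<d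
    d≢multiple (suc q) d≡qL =
      <-irrefl refl (≤-trans d<L (subst (L ≤_) (sym d≡qL) (m≤m+n L (q * L))))

  mod-+-≢ : ∀ x d → 0 < d → d < L → x mod L ≢ (x + d) mod L
  mod-+-≢ x d 0<d d<L eq = +-%-≢ (x % L) d 0<d d<L (sym (begin
    x % L                 ≡⟨ toℕ-mod x ⟨
    toℕ (x mod L)         ≡⟨ cong toℕ eq ⟩
    toℕ ((x + d) mod L)   ≡⟨ toℕ-mod (x + d) ⟩
    (x + d) % L           ≡⟨ %-distribˡ-+ x d L ⟩
    (x % L + d % L) % L   ≡⟨ cong (λ r → (x % L + r) % L) (m<n⇒m%n≡m d<L) ⟩
    (x % L + d) % L       ∎))
    where open ≡-Reasoning

module Construction (M : ℕ) where

  open Counting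
  open Block
  open import Data.Bool.Properties using (¬-not; ∧-zeroʳ; ∧-identityʳ; ∨-identityʳ)
  open import Data.Empty using (⊥)
  open import Data.Fin using (fromℕ<; combine; remQuot)
  open import Data.Fin.Patterns using (0F; 1F; 2F; 3F)
  open import Data.Fin.Properties using (toℕ-injective; toℕ-fromℕ<; remQuot-combine; combine-remQuot)
  open import Data.Fin.Subset using (⊤; _∪_; _∩_; ∁; _∈_) renaming (⊥ to ∅)
  open import Data.Fin.Subset.Properties using (∈⊤)
  open import Data.Nat using (_+_; _*_; _<_; _%_)
  open import Data.Nat.DivMod using (_mod_)
  open import Data.Nat.Properties
    using (≤-refl; ≤-trans; ≤-reflexive; +-monoˡ-≤; *-monoʳ-≤; *-identityʳ; +-suc; +-assoc; +-identityʳ;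
           m≤n+m; <⇒≤; n≤1+n; module ≤-Reasoning)
  open import Data.Product using (proj₁; proj₂; uncurry)
  open import Data.Sum using (_⊎_; [_,_]) renaming (map to ⊎-map)
  open import Data.Vec using (tabulate)
  open import Data.Vec.Properties
    using (lookup∘tabulate; tabulate∘lookup; tabulate-cong; lookup-zipWith; lookup-map; []=⇒lookup; lookup⇒[]=)
  open import Relation.Binary.Definitions using (DecidableEquality)
  open import Relation.Nullary.Decidable using (map′; _×-dec_)

  data Vertex : Set where
    centre : Vertex
    node   : Fin M → Fin (2 + M) → Vertex

  n : ℕ
  n = suc (M * (2 + M))

  enc : Vertex → Fin n
  enc centre     = zero
  enc (node i p) = suc (combine i p)

  dec : Fin n → Vertex
  dec zero    = centre
  dec (suc x) = uncurry node (remQuot (2 + M) x)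

  dec-enc : ∀ d → dec (enc d) ≡ d
  dec-enc centre     = refl
  dec-enc (node i p) = cong (uncurry node) (remQuot-combine i p)

  enc-dec : ∀ x → enc (dec x) ≡ x
  enc-dec zero    = refl
  enc-dec (suc x) = cong suc (combine-remQuot {M} (2 + M) x)

  enc-injective : ∀ {d e} → enc d ≡ enc e → d ≡ e
  enc-injective {d} {e} eq = trans (sym (dec-enc d)) (trans (cong dec eq) (dec-enc e))

  dec-injective : ∀ {x y} → dec x ≡ dec y → x ≡ y
  dec-injective {x} {y} eq = trans (sym (enc-dec x)) (trans (cong enc eq) (enc-dec y))

  node-injective : ∀ {i j p q} → node i p ≡ node j q → i ≡ j × p ≡ q
  node-injective refl = refl , refl

  _≟ⱽ_ : DecidableEquality Vertex
  centre   ≟ⱽ centre   = yes refl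
  centre   ≟ⱽ node _ _ = no λ ()
  node _ _ ≟ⱽ centre   = no λ ()
  node i p ≟ⱽ node j q = map′ (uncurry (cong₂ node)) node-injective ((i ≟ j) ×-dec (p ≟ q))

  does-enc : ∀ d e → does (enc d ≟ enc e) ≡ does (d ≟ⱽ e)
  does-enc d e with d ≟ⱽ e
  ... | yes refl = does-≟-refl (enc d)
  ... | no  d≢e  = dec-false (enc d ≟ enc e) (d≢e ∘ enc-injective)

  adjⱽ : Vertex → Vertex → Bool
  adjⱽ centre     centre     = false
  adjⱽ centre     (node _ p) = does (0F ≟ p)
  adjⱽ (node _ p) centre     = does (0F ≟ p)
  adjⱽ (node i p) (node j q) = does (i ≟ j) ∧ blockAdj p q

  adjⱽ-sym : ∀ d e → adjⱽ d e ≡ adjⱽ e d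
  adjⱽ-sym centre     centre     = refl
  adjⱽ-sym centre     (node _ _) = refl
  adjⱽ-sym (node _ _) centre     = refl
  adjⱽ-sym (node i p) (node j q) = cong₂ _∧_ (does-≟-sym i j) (blockAdj-sym p q)

  adjⱽ-irrefl : ∀ d → adjⱽ d d ≡ false
  adjⱽ-irrefl centre     = refl
  adjⱽ-irrefl (node i p) = trans (cong (does (i ≟ i) ∧_) (blockAdj-irrefl p)) (∧-zeroʳ _)

  adjⱽ-same-block : ∀ i p q → adjⱽ (node i p) (node i q) ≡ blockAdj p q
  adjⱽ-same-block i p q = cong (_∧ blockAdj p q) (does-≟-refl i)

  same-block : ∀ i j p q → adjⱽ (node i p) (node j q) ≡ true → i ≡ j
  same-block i j _ _ a with i ≟ j
  ... | yes i≡j = i≡j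
  ... | no  _   with () ← a

  G : Graph n
  G = record
    { adj    = λ x y → adjⱽ (dec x) (dec y)
    ; sym    = λ x y → adjⱽ-sym (dec x) (dec y)
    ; irrefl = λ x → adjⱽ-irrefl (dec x)
    }

  adj-enc : ∀ d e → adj G (enc d) (enc e) ≡ adjⱽ d e
  adj-enc d e = cong₂ adjⱽ (dec-enc d) (dec-enc e)

  countⱽ : (Vertex → Bool) → ℕ
  countⱽ P = bit (P centre) + ∑ λ i → count (P ∘ node i)

  countⱽ-cong : ∀ {P Q} → (∀ d → P d ≡ Q d) → countⱽ P ≡ countⱽ Q
  countⱽ-cong eq = cong₂ _+_ (cong bit (eq centre)) (∑-cong λ i → count-cong (eq ∘ node i))

  ∣∣≡countⱽ : ∀ X → ∣ X ∣ ≡ countⱽ (lookup X ∘ enc)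
  ∣∣≡countⱽ X =
    trans (∣p∣≡count X) (cong (bit (lookup X zero) +_) (∑-combine M (bit ∘ lookup X ∘ suc)))

  ⟦_⟧ : (Vertex → Bool) → Subset n
  ⟦ P ⟧ = tabulate (P ∘ dec)

  lookup-⟦⟧ : ∀ P d → lookup ⟦ P ⟧ (enc d) ≡ P d
  lookup-⟦⟧ P d = trans (lookup∘tabulate (P ∘ dec) (enc d)) (cong P (dec-enc d))

  ∈⟦⟧⁺ : ∀ P {d} → P d ≡ true → enc d ∈ ⟦ P ⟧
  ∈⟦⟧⁺ P {d} Pd = lookup⇒[]= (enc d) ⟦ P ⟧ (trans (lookup-⟦⟧ P d) Pd)

  ∈⟦⟧⁻ : ∀ P {x} → x ∈ ⟦ P ⟧ → P (dec x) ≡ true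
  ∈⟦⟧⁻ P {x} x∈ = trans (sym (lookup∘tabulate (P ∘ dec) x)) ([]=⇒lookup x∈)

  ≡⟦⟧ : ∀ {X P} → (∀ d → lookup X (enc d) ≡ P d) → X ≡ ⟦ P ⟧
  ≡⟦⟧ {X} {P} eq = trans (sym (tabulate∘lookup X)) (tabulate-cong λ x →
    trans (cong (lookup X) (sym (enc-dec x))) (eq (dec x)))

  ∅≡⟦⟧ : ∀ {P} → (∀ d → P d ≡ false) → ∅ ≡ ⟦ P ⟧
  ∅≡⟦⟧ none = ≡⟦⟧ λ d → trans (lookup-replicate (enc d) false) (sym (none d))

  ∣⟦⟧∣ : ∀ P → ∣ ⟦ P ⟧ ∣ ≡ countⱽ P
  ∣⟦⟧∣ P = trans (∣∣≡countⱽ ⟦ P ⟧) (countⱽ-cong (lookup-⟦⟧ P))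

  lookup-⁅⁆∪ : ∀ X v d → lookup (⁅ enc v ⁆ ∪ X) (enc d) ≡ does (v ≟ⱽ d) ∨ lookup X (enc d)
  lookup-⁅⁆∪ X v d = trans (lookup-zipWith _∨_ (enc d) ⁅ enc v ⁆ X)
    (cong (_∨ lookup X (enc d)) (trans (lookup-⁅⁆ (enc v) (enc d)) (does-enc v d)))

  lookup-N : ∀ v d → lookup (N G (enc v)) (enc d) ≡ adjⱽ v d
  lookup-N v d = trans (lookup∘tabulate (adj G (enc v)) (enc d)) (adj-enc v d)

  lookup-remove : ∀ X v d →
                  lookup (remove G X (enc v)) (enc d) ≡ lookup X (enc d) ∧ not (does (v ≟ⱽ d) ∨ adjⱽ v d)
  lookup-remove X v d = begin
    lookup (X ∩ ∁ deleted) (enc d)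
      ≡⟨ lookup-zipWith _∧_ (enc d) X (∁ deleted) ⟩
    lookup X (enc d) ∧ lookup (∁ deleted) (enc d)
      ≡⟨ cong (lookup X (enc d) ∧_) (lookup-map (enc d) not deleted) ⟩
    lookup X (enc d) ∧ not (lookup deleted (enc d))
      ≡⟨ cong (λ b → lookup X (enc d) ∧ not b) (lookup-⁅⁆∪ _ v d) ⟩
    lookup X (enc d) ∧ not (does (v ≟ⱽ d) ∨ lookup (N G (enc v)) (enc d))
      ≡⟨ cong (λ b → lookup X (enc d) ∧ not (does (v ≟ⱽ d) ∨ b)) (lookup-N v d) ⟩
    lookup X (enc d) ∧ not (does (v ≟ⱽ d) ∨ adjⱽ v d) ∎
    where
    open ≡-Reasoning
    deleted : Subset n
    deleted = ⁅ enc v ⁆ ∪ N G (enc v)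

  deg-enc : ∀ X v → deg G X (enc v) ≡ countⱽ (λ d → lookup X (enc d) ∧ adjⱽ v d)
  deg-enc X v = trans (∣∣≡countⱽ (X ∩ N G (enc v))) (countⱽ-cong λ d →
    trans (lookup-zipWith _∧_ (enc d) X (N G (enc v)))
          (cong (lookup X (enc d) ∧_) (lookup-N v d)))

  Independentⱽ : (Vertex → Bool) → Set
  Independentⱽ P = ∀ d e → P d ≡ true → P e ≡ true → adjⱽ d e ≡ false

  independent⇒independentⱽ : ∀ {X} → Independent G X → Independentⱽ (lookup X ∘ enc)
  independent⇒independentⱽ {X} independent d e Xd Xe = trans (sym (adj-enc d e))
    (¬-not (independent (enc d) (enc e) (lookup⇒[]= _ X Xd) (lookup⇒[]= _ X Xe)))

  independentⱽ⇒independent : ∀ {P} → Independentⱽ P → Independent G ⟦ P ⟧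
  independentⱽ⇒independent {P} independent x y x∈ y∈ x~y
    with () ← trans (sym x~y) (independent (dec x) (dec y) (∈⟦⟧⁻ P x∈) (∈⟦⟧⁻ P y∈))

  independentⱽ-in-block : ∀ {P} → Independentⱽ P →
                          ∀ i p q → P (node i p) ≡ true → P (node i q) ≡ true → blockAdj p q ≡ false
  independentⱽ-in-block independent i p q Pp Pq =
    trans (sym (adjⱽ-same-block i p q)) (independent _ _ Pp Pq)

  countⱽ-independent : 1 ≤ M → ∀ {P} → Independentⱽ P → countⱽ P ≤ M * 2
  countⱽ-independent 1≤M {P} independent with P centre in P-centre
  ... | true  = ≤-trans (s≤s (∑-bounded 1 at-most-one)) (1+m≤m*2 1≤M)
    where
    port-excluded : ∀ i → P (node i 0F) ≡ false
    port-excluded i with P (node i 0F) in P-port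
    ... | true  with () ← independent centre (node i 0F) P-centre P-port
    ... | false = refl
    at-most-one : ∀ i → count (P ∘ node i) ≤ 1
    at-most-one i = subst (λ b → count (P ∘ node i) ≤ bit b + 1) (port-excluded i)
      (count-independent _ (independentⱽ-in-block independent i))
    1+m≤m*2 : ∀ {m} → 1 ≤ m → suc (m * 1) ≤ m * 2
    1+m≤m*2 {suc m} _ = s≤s (s≤s (*-monoʳ-≤ m (n≤1+n 1)))
  ... | false = ∑-bounded 2 λ i →
    ≤-trans (count-independent _ (independentⱽ-in-block independent i)) (+-monoˡ-≤ 1 (bit≤1 _))

  lowⱽ : Vertex → Bool
  lowⱽ centre     = false
  lowⱽ (node _ p) = low p

  lowⱽ-independent : Independentⱽ lowⱽ
  lowⱽ-independent (node i p) (node j q) lp lq =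
    trans (cong (does (i ≟ j) ∧_) (low⇒non-adjacent lp lq)) (∧-zeroʳ _)

  countⱽ-lowⱽ : countⱽ lowⱽ ≡ M * 2
  countⱽ-lowⱽ = ∑-constant {M} 2 λ _ → count-low M

  independence-number : 1 ≤ M → IsIndependenceNumber G (M * 2)
  independence-number 1≤M =
    (⟦ lowⱽ ⟧ , independentⱽ⇒independent lowⱽ-independent , trans (∣⟦⟧∣ lowⱽ) countⱽ-lowⱽ) ,
    λ I independent → subst (_≤ M * 2) (sym (∣∣≡countⱽ I))
                        (countⱽ-independent 1≤M (independent⇒independentⱽ independent))

  module Walk {m : ℕ} (c : Fin (suc m) → Fin n) (cycle : IsCycle G c) where

    open Modular (suc m)

    walk : Fin (suc m) → ℕ → Vertex
    walk t k = dec (c ((toℕ t + k) mod suc m))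

    walk-start : ∀ t → walk t 0 ≡ dec (c t)
    walk-start t =
      cong (dec ∘ c) (trans (cong (_mod suc m) (+-identityʳ (toℕ t))) (toℕ-mod-toℕ t))

    walk-period : ∀ t → walk t (suc m) ≡ dec (c t)
    walk-period t = cong (dec ∘ c) (trans (+-mod-period (toℕ t)) (toℕ-mod-toℕ t))

    walk-step : ∀ t k → adjⱽ (walk t k) (walk t (suc k)) ≡ true
    walk-step t k = subst (λ x → adjⱽ (walk t k) (dec (c (x mod suc m))) ≡ true)
      (sym (+-suc (toℕ t) k)) (proj₂ cycle _ _ (toℕ-suc-mod (toℕ t + k)))

    walk-≢ : ∀ t j d → 0 < d → d < suc m → walk t j ≢ walk t (j + d)
    walk-≢ t j d 0<d d<L eq = mod-+-≢ (toℕ t + j) d 0<d d<L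
      (trans (proj₁ cycle (dec-injective eq)) (cong (_mod suc m) (sym (+-assoc (toℕ t) j d))))

  InBlock : Fin M → Vertex → Set
  InBlock b centre     = ⊥
  InBlock b (node i _) = i ≡ b

  inBlock : ∀ d → d ≢ centre → ∃[ b ] InBlock b d
  inBlock centre     d≢centre = ⊥-elim (d≢centre refl)
  inBlock (node i _) _        = i , refl

  inBlock-step : ∀ {b d e} → InBlock b d → adjⱽ d e ≡ true → e ≢ centre → InBlock b e
  inBlock-step {d = node _ _} {centre}   _    _ e≢centre = ⊥-elim (e≢centre refl)
  inBlock-step {d = node i p} {node j q} refl a _        = sym (same-block i j p q a)

  port-of-block : ∀ {b d} → InBlock b d → adjⱽ centre d ≡ true → d ≡ node b 0F
  port-of-block {d = node _ 0F}      refl _  = refl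
  port-of-block {d = node _ (suc _)} _    ()

  -- The centre separates the blocks and meets each one only in its port, so a cycle through
  -- the centre would leave and re-enter the same block through the same vertex.
  centre-off-cycle : ∀ {k} (c : Fin (3 + k) → Fin n) → IsCycle G c → ∀ t → dec (c t) ≢ centre
  centre-off-cycle {k} c cycle t ct≡centre =
    walk-≢ t 1 (suc k) (s≤s z≤n) (s≤s (n≤1+n (suc k)))
      (trans (port-of-block (stays 0 z≤n) first) (sym (port-of-block (stays (suc k) ≤-refl) last)))
    where
    open Walk c cycle
    W₀≡centre : walk t 0 ≡ centre
    W₀≡centre = trans (walk-start t) ct≡centre
    off : ∀ j → 0 < j → j < 3 + k → walk t j ≢ centre
    off j 0<j j<L Wj≡centre = walk-≢ t 0 j 0<j j<L (trans W₀≡centre (sym Wj≡centre))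
    start : ∃[ b ] InBlock b (walk t 1)
    start = inBlock (walk t 1) (off 1 (s≤s z≤n) (s≤s (s≤s z≤n)))
    stays : ∀ j → j ≤ suc k → InBlock (proj₁ start) (walk t (suc j))
    stays zero    _ = proj₂ start
    stays (suc j) h = inBlock-step (stays j (≤-trans (n≤1+n j) h)) (walk-step t (suc j))
                        (off (suc (suc j)) (s≤s z≤n) (s≤s (s≤s h)))
    first : adjⱽ centre (walk t 1) ≡ true
    first = subst (λ d → adjⱽ d (walk t 1) ≡ true) W₀≡centre (walk-step t 0)
    last : adjⱽ centre (walk t (2 + k)) ≡ true
    last = trans (adjⱽ-sym centre (walk t (2 + k))) (subst (λ d → adjⱽ (walk t (2 + k)) d ≡ true)
      (trans (walk-period t) ct≡centre) (walk-step t (2 + k)))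

  path-chord : ∀ d₀ d₁ d₂ d₃ → d₀ ≢ centre → d₁ ≢ centre → d₂ ≢ centre → d₃ ≢ centre →
               adjⱽ d₀ d₁ ≡ true → adjⱽ d₁ d₂ ≡ true → adjⱽ d₂ d₃ ≡ true → d₀ ≢ d₂ → d₁ ≢ d₃ →
               adjⱽ d₀ d₂ ≡ true ⊎ adjⱽ d₁ d₃ ≡ true
  path-chord centre _      _      _      c₀ _  _  _  = ⊥-elim (c₀ refl)
  path-chord _      centre _      _      _  c₁ _  _  = ⊥-elim (c₁ refl)
  path-chord _      _      centre _      _  _  c₂ _  = ⊥-elim (c₂ refl)
  path-chord _      _      _      centre _  _  _  c₃ = ⊥-elim (c₃ refl)
  path-chord (node i p₀) (node i₁ p₁) (node i₂ p₂) (node i₃ p₃) _ _ _ _ a₀₁ a₁₂ a₂₃ d₀≢d₂ d₁≢d₃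
    with refl ← same-block i i₁ p₀ p₁ a₀₁
       | refl ← same-block i₁ i₂ p₁ p₂ a₁₂
       | refl ← same-block i₂ i₃ p₂ p₃ a₂₃
    = ⊎-map (trans (adjⱽ-same-block i p₀ p₂)) (trans (adjⱽ-same-block i p₁ p₃))
        (block-chord (trans (sym (adjⱽ-same-block i p₀ p₁)) a₀₁)
                     (d₀≢d₂ ∘ cong (node i)) (d₁≢d₃ ∘ cong (node i)))

  chordal : Chordal G
  chordal (suc (suc (suc k))) (s≤s (s≤s (s≤s _))) c cycle@(injective , adjacent) =
    [ (λ a₀₂ → 0F , 2F , (λ ()) , (λ ()) , (λ ()) , a₀₂)
    , (λ a₁₃ → 1F , 3F , (λ ()) , (λ ()) , 3↛1 k , a₁₃)
    ] (path-chord _ _ _ _ (off 0F) (off 1F) (off 2F) (off 3F)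
         (adjacent 0F 1F refl) (adjacent 1F 2F refl) (adjacent 2F 3F refl)
         (distinct λ ()) (distinct λ ()))
    where
    off : ∀ t → dec (c t) ≢ centre
    off = centre-off-cycle c cycle
    distinct : ∀ {i j} → i ≢ j → dec (c i) ≢ dec (c j)
    distinct i≢j = i≢j ∘ injective ∘ dec-injective
    3↛1 : ∀ k → 1 ≢ 4 % (4 + k)
    3↛1 zero    ()
    3↛1 (suc k) ()

  alive : ℕ → Vertex → Bool
  alive j centre     = false
  alive j (node i p) = (toℕ i <ᵇ j) ∧ not (does (0F ≟ p))

  twins : ℕ → Vertex → Bool
  twins j centre     = false
  twins j (node i p) = (toℕ i <ᵇ j) ∧ does (1F ≟ p)

  countⱽ-alive-neighbours : ∀ j i p → (toℕ i <ᵇ j) ≡ true →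
                            countⱽ (λ d → alive j d ∧ adjⱽ (node i (suc p)) d) ≡ M
  countⱽ-alive-neighbours j i p i-alive = trans (∑-single _ i others) (begin
    count (λ q → ((toℕ i <ᵇ j) ∧ not (does (0F ≟ q))) ∧ (does (i ≟ i) ∧ blockAdj (suc p) q))
      ≡⟨ count-cong (λ q → cong₂ (λ a b → (a ∧ not (does (0F ≟ q))) ∧ (b ∧ blockAdj (suc p) q))
                                 i-alive (does-≟-refl i)) ⟩
    count (λ q → not (does (0F ≟ q)) ∧ blockAdj (suc p) q)
      ≡⟨ count-≢ p ⟩
    M ∎)
    where
    open ≡-Reasoning
    others : ∀ i′ → i ≢ i′ → count (λ q → alive j (node i′ q) ∧ adjⱽ (node i (suc p)) (node i′ q)) ≡ 0
    others i′ i≢i′ = count-false λ q → trans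
      (cong (λ b → alive j (node i′ q) ∧ (b ∧ blockAdj (suc p) q)) (dec-false (i ≟ i′) i≢i′)) (∧-zeroʳ _)

  deg-alive : ∀ j v → alive j v ≡ true → deg G ⟦ alive j ⟧ (enc v) ≡ M
  deg-alive j v v-alive = trans (deg-enc ⟦ alive j ⟧ v)
    (trans (countⱽ-cong λ d → cong (_∧ adjⱽ v d) (lookup-⟦⟧ (alive j) d)) (neighbours v v-alive))
    where
    neighbours : ∀ v → alive j v ≡ true → countⱽ (λ d → alive j d ∧ adjⱽ v d) ≡ M
    neighbours (node i 0F)      h with () ← trans (sym (∧-zeroʳ (toℕ i <ᵇ j))) h
    neighbours (node i (suc p)) h = countⱽ-alive-neighbours j i p (trans (sym (∧-identityʳ _)) h)

  regular⇒minimum-degree : ∀ {P v} r → (∀ d → P d ≡ true → deg G ⟦ P ⟧ (enc d) ≡ r) →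
                           P v ≡ true → ∀ x → x ∈ ⟦ P ⟧ → deg G ⟦ P ⟧ (enc v) ≤ deg G ⟦ P ⟧ x
  regular⇒minimum-degree {P} {v} r regular Pv x x∈ =
    ≤-reflexive (trans (regular v Pv) (sym (begin
    deg G ⟦ P ⟧ x             ≡⟨ cong (deg G ⟦ P ⟧) (enc-dec x) ⟨
    deg G ⟦ P ⟧ (enc (dec x)) ≡⟨ regular (dec x) (∈⟦⟧⁻ P x∈) ⟩
    r                         ∎)))
    where open ≡-Reasoning

  remove-twin : ∀ i → remove G ⟦ alive (suc (toℕ i)) ⟧ (enc (node i 1F)) ≡ ⟦ alive (toℕ i) ⟧
  remove-twin i = ≡⟦⟧ λ d → trans (lookup-remove ⟦ alive (suc (toℕ i)) ⟧ (node i 1F) d)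
    (trans (cong (_∧ not (does (node i 1F ≟ⱽ d) ∨ adjⱽ (node i 1F) d)) (lookup-⟦⟧ (alive (suc (toℕ i))) d))
           (pointwise d))
    where
    in-block : ∀ i′ q → ((toℕ i′ <ᵇ suc (toℕ i)) ∧ not (does (0F ≟ q))) ∧
                         not (does (i ≟ i′) ∧ does (1F ≟ q) ∨ does (i ≟ i′) ∧ blockAdj 1F q)
                       ≡ (toℕ i′ <ᵇ toℕ i) ∧ not (does (0F ≟ q))
    in-block i′ q with i ≟ i′
    ... | yes refl rewrite n<ᵇ1+n≡true (toℕ i) | n<ᵇn≡false (toℕ i) = twin-dominates q
    ... | no  i≢i′ = trans (∧-identityʳ _)
                       (cong (_∧ not (does (0F ≟ q))) (<ᵇ-suc (i≢i′ ∘ sym ∘ toℕ-injective)))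
    pointwise : ∀ d → alive (suc (toℕ i)) d ∧ not (does (node i 1F ≟ⱽ d) ∨ adjⱽ (node i 1F) d)
                      ≡ alive (toℕ i) d
    pointwise centre      = refl
    pointwise (node i′ q) = in-block i′ q

  ⁅twin⁆∪twins : ∀ i → ⁅ enc (node i 1F) ⁆ ∪ ⟦ twins (toℕ i) ⟧ ≡ ⟦ twins (suc (toℕ i)) ⟧
  ⁅twin⁆∪twins i = ≡⟦⟧ λ d → trans (lookup-⁅⁆∪ ⟦ twins (toℕ i) ⟧ (node i 1F) d)
    (trans (cong (does (node i 1F ≟ⱽ d) ∨_) (lookup-⟦⟧ (twins (toℕ i)) d)) (pointwise d))
    where
    in-block : ∀ i′ q → does (i ≟ i′) ∧ does (1F ≟ q) ∨ (toℕ i′ <ᵇ toℕ i) ∧ does (1F ≟ q)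
                       ≡ (toℕ i′ <ᵇ suc (toℕ i)) ∧ does (1F ≟ q)
    in-block i′ q with i ≟ i′
    ... | yes refl rewrite n<ᵇ1+n≡true (toℕ i) | n<ᵇn≡false (toℕ i) = ∨-identityʳ _
    ... | no  i≢i′ = cong (_∧ does (1F ≟ q)) (sym (<ᵇ-suc (i≢i′ ∘ sym ∘ toℕ-injective)))
    pointwise : ∀ d → does (node i 1F ≟ⱽ d) ∨ twins (toℕ i) d ≡ twins (suc (toℕ i)) d
    pointwise centre      = refl
    pointwise (node i′ q) = in-block i′ q

  -- Once the centre is gone, the first j blocks minus their ports are disjoint cliques of size
  -- M + 1, so every vertex has degree M and Greedy may take the twins one block at a time.
  greedy-run : ∀ j → j ≤ M → GreedyRun G ⟦ alive j ⟧ ⟦ twins j ⟧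
  greedy-run zero _ = subst₂ (GreedyRun G) (∅≡⟦⟧ none-alive) (∅≡⟦⟧ none-chosen) done
    where
    none-alive : ∀ d → alive 0 d ≡ false
    none-alive centre     = refl
    none-alive (node _ _) = refl
    none-chosen : ∀ d → twins 0 d ≡ false
    none-chosen centre     = refl
    none-chosen (node _ _) = refl
  greedy-run (suc j) j<M with fromℕ< j<M | toℕ-fromℕ< j<M
  ... | i | refl = subst (GreedyRun G ⟦ alive (suc (toℕ i)) ⟧) (⁅twin⁆∪twins i)
    (step (enc (node i 1F)) (∈⟦⟧⁺ (alive (suc (toℕ i))) twin-alive)
          (regular⇒minimum-degree M (deg-alive (suc (toℕ i))) twin-alive)
          (subst (λ X → GreedyRun G X ⟦ twins (toℕ i) ⟧) (sym (remove-twin i)) (greedy-run (toℕ i) (<⇒≤ j<M))))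
    where
    twin-alive : alive (suc (toℕ i)) (node i 1F) ≡ true
    twin-alive = trans (∧-identityʳ _) (n<ᵇ1+n≡true (toℕ i))

  deg-⊤ : ∀ v → deg G ⊤ (enc v) ≡ countⱽ (adjⱽ v)
  deg-⊤ v =
    trans (deg-enc ⊤ v) (countⱽ-cong λ d → cong (_∧ adjⱽ v d) (lookup-replicate (enc d) true))

  countⱽ-adjⱽ-centre : countⱽ (adjⱽ centre) ≡ M
  countⱽ-adjⱽ-centre = trans (∑-constant {M} 1 λ _ → count-≟ {2 + M} 0F) (*-identityʳ M)

  M≤countⱽ-adjⱽ : ∀ v → M ≤ countⱽ (adjⱽ v)
  M≤countⱽ-adjⱽ centre     = ≤-reflexive (sym countⱽ-adjⱽ-centre)
  M≤countⱽ-adjⱽ (node i p) = begin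
    M                                             ≤⟨ count-blockAdj p ⟩
    count (blockAdj p)                            ≡⟨ count-cong (adjⱽ-same-block i p) ⟨
    count (adjⱽ (node i p) ∘ node i)              ≤⟨ ∑-term (λ i′ → count (adjⱽ (node i p) ∘ node i′)) i ⟩
    ∑ (λ i′ → count (adjⱽ (node i p) ∘ node i′))  ≤⟨ m≤n+m _ (bit (adjⱽ (node i p) centre)) ⟩
    countⱽ (adjⱽ (node i p))                      ∎
    where open ≤-Reasoning

  centre-minimum-degree : ∀ x → x ∈ ⊤ → deg G ⊤ (enc centre) ≤ deg G ⊤ x
  centre-minimum-degree x _ = subst₂ _≤_ (sym (trans (deg-⊤ centre) countⱽ-adjⱽ-centre))
    (trans (sym (deg-⊤ (dec x))) (cong (deg G ⊤) (enc-dec x))) (M≤countⱽ-adjⱽ (dec x))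

  remove-centre : remove G ⊤ (enc centre) ≡ ⟦ alive M ⟧
  remove-centre = ≡⟦⟧ λ d → trans (lookup-remove ⊤ centre d)
    (trans (cong (_∧ not (does (centre ≟ⱽ d) ∨ adjⱽ centre d)) (lookup-replicate (enc d) true))
           (pointwise d))
    where
    pointwise : ∀ d → not (does (centre ≟ⱽ d) ∨ adjⱽ centre d) ≡ alive M d
    pointwise centre     = refl
    pointwise (node i p) = sym (cong (_∧ not (does (0F ≟ p))) (toℕ<ᵇn≡true i))

  greedy-solution : Subset n
  greedy-solution = ⁅ enc centre ⁆ ∪ ⟦ twins M ⟧

  greedy-output : GreedyOutput G greedy-solution
  greedy-output = step (enc centre) ∈⊤ centre-minimum-degree
    (subst (λ X → GreedyRun G X ⟦ twins M ⟧) (sym remove-centre) (greedy-run M ≤-refl))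

  ∣greedy-solution∣ : ∣ greedy-solution ∣ ≡ suc M
  ∣greedy-solution∣ = begin
    ∣ greedy-solution ∣                            ≡⟨ ∣∣≡countⱽ greedy-solution ⟩
    countⱽ (lookup greedy-solution ∘ enc)          ≡⟨ countⱽ-cong chosen ⟩
    countⱽ (λ d → does (centre ≟ⱽ d) ∨ twins M d)  ≡⟨ cong suc (∑-constant {M} 1 one-twin) ⟩
    suc (M * 1)                                    ≡⟨ cong suc (*-identityʳ M) ⟩
    suc M                                          ∎
    where
    open ≡-Reasoning
    chosen : ∀ d → lookup greedy-solution (enc d) ≡ does (centre ≟ⱽ d) ∨ twins M d
    chosen d = trans (lookup-⁅⁆∪ ⟦ twins M ⟧ centre d)
                     (cong (does (centre ≟ⱽ d) ∨_) (lookup-⟦⟧ (twins M) d))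
    one-twin : ∀ i → count (twins M ∘ node i) ≡ 1
    one-twin i = trans (count-cong {2 + M} λ p → cong (_∧ does (1F ≟ p)) (toℕ<ᵇn≡true i))
                       (count-≟ {2 + M} 1F)

open import Data.Integer using (+_; +<+; +[1+_]; -[1+_])
open import Data.List using (_∷_; [])
import Data.Nat as ℕ
import Data.Nat.Properties as ℕ
open import Data.Nat.Tactic.RingSolver using (solve)
open import Data.Rational using (ℚ; mkℚ; 0ℚ; ½; _<_; _+_; _*_; _/_; toℚᵘ; *<*)
open import Data.Rational.Properties using (toℚᵘ-cancel-<; toℚᵘ-fromℚᵘ; toℚᵘ-homo-+; toℚᵘ-homo-*)
open import Data.Rational.Unnormalised as ℚᵘ using (mkℚᵘ; *≡*)
open import Data.Rational.Unnormalised.Properties using (*-cong; module ≤-Reasoning)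

-- For ε = (p+1)/(d+1) and M = d+1, the right-hand side (½ + ε)·2M is the integer M + 2(p+1).
ratio-bound : (ε : ℚ) → 0ℚ < ε →
              Σ ℕ λ M → 1 ≤ M × (+ suc M) / 1 < (½ + ε) * ((+ (M ℕ.* 2)) / 1)
ratio-bound (mkℚ (+ 0)    _ _) (*<* (+<+ ()))
ratio-bound (mkℚ -[1+ _ ] _ _) (*<* ())
ratio-bound ε@(mkℚ +[1+ p ] d _) _ = M , s≤s z≤n , toℚᵘ-cancel-< (begin-strict
  toℚᵘ ((+ suc M) / 1)                           ≃⟨ toℚᵘ-fromℚᵘ (mkℚᵘ (+ suc M) 0) ⟩
  mkℚᵘ (+ suc M) 0                               <⟨ ℚᵘ.*<* (+<+ (ℕ.*-monoˡ-< 1 M+1<M+2[p+1])) ⟩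
  mkℚᵘ (+ (M ℕ.+ 2 ℕ.* suc p)) 0                 ≃⟨ *≡* (cong +_ (solve (p ∷ d ∷ []))) ⟨
  (toℚᵘ ½ ℚᵘ.+ toℚᵘ ε) ℚᵘ.* mkℚᵘ (+ 2M) 0        ≃⟨ *-cong (toℚᵘ-homo-+ ½ ε) (toℚᵘ-fromℚᵘ (mkℚᵘ (+ 2M) 0)) ⟨
  toℚᵘ (½ + ε) ℚᵘ.* toℚᵘ ((+ 2M) / 1)            ≃⟨ toℚᵘ-homo-* (½ + ε) ((+ 2M) / 1) ⟨
  toℚᵘ ((½ + ε) * ((+ 2M) / 1))                  ∎)
  where
  open ≤-Reasoning
  M 2M : ℕ
  M  = suc d
  2M = M ℕ.* 2
  M+1<M+2[p+1] : suc M ℕ.< M ℕ.+ 2 ℕ.* suc p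
  M+1<M+2[p+1] =
    subst (ℕ._< M ℕ.+ 2 ℕ.* suc p) (ℕ.+-comm M 1) (ℕ.+-monoʳ-< M (ℕ.*-monoʳ-≤ 2 (s≤s z≤n)))

lemma5 : (ε : ℚ) → 0ℚ < ε →
    ∃[ n ] Σ (Graph n) λ G → Chordal G ×
      Σ (Subset n) λ S → GreedyOutput G S ×
        Σ ℕ λ α → IsIndependenceNumber G α ×
          ((+ ∣ S ∣) / 1) < ((½ + ε) * ((+ α) / 1))
lemma5 ε 0<ε with ratio-bound ε 0<ε
... | M , 1≤M , bound =
  n , G , chordal , greedy-solution , greedy-output , _ , independence-number 1≤M ,
  subst (λ s → (+ s) / 1 < (½ + ε) * ((+ (M ℕ.* 2)) / 1)) (sym ∣greedy-solution∣) bound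
  where open Construction M
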